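{- Let $Z\in\{H,V\}^k$ contain $h$ occurrences of $H$ and $v$ occurrences of $V$. Let $B_1,B_2,B_3$ be $Z$-blocks with $B_2^+=B_1^++(h,-v)$ and $B_3^+=B_1^++(h,v)$. Let $T_1=(P_1,c_1)$ be a positive $Z$-bridge connecting $B_1$ to $B_2$ and $T_2=(P_2,c_2)$ a positive $Z$-bridge connecting $B_1$ to $B_3$, and let $c=c_1\oplus c_2$ (the configuration of the positive semi-duplicator). If $T_1$ or $T_2$ is a source bridge, then $F(c,Z)(B_2^+)=F(c,Z)(B_3^+)=4$.
   Context: Cells are $\mathbb{Z}^2$; $H=(1,0)$, $V=(0,1)$ (second coordinate increasing downward). Configurations are maps $c:\mathbb{Z}^2\to\{0,\dots,5\}$; updates: $F(c,H)(x)=c(x)-2[c(x)\ge4]+[c(x+H)\ge4]+[c(x-H)\ge4]$, and $F(c,V)$ likewise with $V$. For $Z=Z(1)\cdots Z(k)$: $F(c,Z,0)=c$, $F(c,Z,s)=F(F(c,Z,s-1),Z(s))$ for $1\le s\le k$, and $F(c,Z)=F(c,Z,k)$. $Z$-blocks: the rectangles $a+(ih,jv)+\{0,\dots,h-1\}\times\{0,\dots,v-1\}$ of a fixed partition of $\mathbb{Z}^2$; $B^+$ is the upper-left cell of block $B$. A $Z$-path is $P=(P(0),\dots,P(l))$, $l\le k$, such that for some $\alpha,\beta\in\{ -1,1\}$ and all $1\le s\le l$, $P(s)=P(s-1)+\alpha H$ if $Z(s)=H$ and $P(s)=P(s-1)+\beta V$ if $Z(s)=V$. A positive $Z$-bridge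 connecting blocks $B,B'$ with $B'^+=B^++(\pm h,\pm v)$ is a pair $(P,c)$ with $P=(P(0),\dots,P(k))$ a $Z$-path, $P(0)=B^+$, $P(k)=B'^+$, and $c=3$ on $P$ and $0$ elsewhere; it is a source bridge if instead $c(P(0))=4$. For configurations $c_1,c_2$, $c_1\oplus c_2$ takes value $2$ at $x$ if $c_1(x)=2$ or $c_2(x)=2$, and $\max(c_1(x),c_2(x))$ otherwise. -}

module Defs where

open import Data.Nat using (ℕ; zero; suc; _∸_; _≤ᵇ_; _⊔_)
import Data.Nat as ℕ
open import Data.Integer using (ℤ; +_; -[1+_]) renaming (_+_ to _+ℤ_; _*_ to _*ℤ_)
open import Data.Bool using (Bool; true; false; if_then_else_; _∨_)
open import Data.Product using (_×_; _,_; Σ; ∃; ∃-syntax)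
open import Data.Sum using (_⊎_)
open import Data.Fin using (Fin; zero; suc; inject₁; fromℕ)
open import Data.Vec using (Vec; lookup; count)
open import Relation.Binary.PropositionalEquality using (_≡_; _≢_)
open import Relation.Nullary using (¬_; Dec; yes; no)

-- Cells: ℤ², first coordinate horizontal, second coordinate increasing downward.
Cell : Set
Cell = ℤ × ℤ

_+c_ : Cell → Cell → Cell
(a , b) +c (c , d) = (a +ℤ c , b +ℤ d)

data Dir : Set where
  H V : Dir

isH? : (d : Dir) → Dec (d ≡ H)
isH? H = yes _≡_.refl
isH? V = no (λ ())

isV? : (d : Dir) → Dec (d ≡ V)
isV? H = no (λ ())
isV? V = yes _≡_.refl

dirVec : Dir → Cell
dirVec H = (+ 1 , + 0)
dirVec V = (+ 0 , + 1)

negC : Cell → Cell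
negC (a , b) = (Data.Integer.- a , Data.Integer.- b)

-- Configurations (values are meant to lie in {0,…,5}).
Config : Set
Config = Cell → ℕ

ind4 : ℕ → ℕ
ind4 n = if 4 ≤ᵇ n then 1 else 0

F1 : Config → Dir → Config
F1 c d x = (c x ∸ 2 ℕ.* ind4 (c x)) ℕ.+ ind4 (c (x +c dirVec d)) ℕ.+ ind4 (c (x +c negC (dirVec d)))

F : ∀ {k} → Config → Vec Dir k → Config
F c Data.Vec.[] = c
F c (d Data.Vec.∷ Z) = F (F1 c d) Z

#H #V : ∀ {k} → Vec Dir k → ℕ
#H Z = count isH? Z
#V Z = count isV? Z

-- Upper-left corner of block (i,j) of the Z-block partition with anchor a and
-- block sizes h × v:  a + (i h, j v).
blockCorner : Cell → ℕ → ℕ → ℤ → ℤ → Cell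
blockCorner a h v i j = a +c (i *ℤ + h , j *ℤ + v)

data Sign : Set where
  plus minus : Sign

sgn : Sign → ℤ
sgn plus = + 1
sgn minus = -[1+ 0 ]

scale : ℤ → Cell → Cell
scale s (a , b) = (s *ℤ a , s *ℤ b)

step : Sign → Sign → Dir → Cell
step α β H = scale (sgn α) (dirVec H)
step α β V = scale (sgn β) (dirVec V)

IsZPath : ∀ {k} → Vec Dir k → (Fin (suc k) → Cell) → Set
IsZPath {k} Z P = ∃[ α ] ∃[ β ] ((s : Fin k) → P (suc s) ≡ P (inject₁ s) +c step α β (lookup Z s))

OnPath : ∀ {k} → (Fin (suc k) → Cell) → Cell → Set
OnPath {k} P x = ∃[ s ] P s ≡ x

-- Positive Z-bridge (P,c) from the cell p (= B^+) to the cell q (= B'^+)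
PositiveBridge : ∀ {k} → Vec Dir k → Cell → Cell → (Fin (suc k) → Cell) → Config → Set
PositiveBridge {k} Z p q P c =
  IsZPath Z P × P zero ≡ p × P (fromℕ k) ≡ q
  × (∀ x → OnPath P x → c x ≡ 3)
  × (∀ x → ¬ OnPath P x → c x ≡ 0)

SourceBridge : ∀ {k} → Vec Dir k → Cell → Cell → (Fin (suc k) → Cell) → Config → Set
SourceBridge {k} Z p q P c =
  IsZPath Z P × P zero ≡ p × P (fromℕ k) ≡ q
  × c (P zero) ≡ 4
  × (∀ x → OnPath P x → x ≢ P zero → c x ≡ 3)
  × (∀ x → ¬ OnPath P x → c x ≡ 0)

_⊕_ : Config → Config → Config
(c₁ ⊕ c₂) x = if ((c₁ x ℕ.≡ᵇ 2) ∨ (c₂ x ℕ.≡ᵇ 2)) then 2 else (c₁ x ⊔ c₂ x)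

{-# OPTIONS --safe #-}
module Submission where

-- Let α, β be the signs of a Z-path P and π(y) = α y₁ + β y₂, so that π grows by exactly one along
-- each step of P. A toppling in direction H or V only exchanges chips between cells whose π differs
-- by one; hence if every cell with π > r carries at most 3, one toppling leaves every cell with
-- π > r + 1 unchanged. Inductively, after s steps P(s) carries 4 while everything beyond it, in
-- particular the rest of P, is as initially, so the next toppling raises the 3 at P(s+1) to 4 and
-- nothing further ahead fires. In c₁ ⊕ c₂ every cell except the common origin B₁⁺ carries 0 or 3,
-- the cells of P₁ and P₂ carry 3, and B₁⁺ carries 4 because one bridge is a source, so the signal
-- reaches the ends of both bridges.

open import Defs
open import Data.Nat using (ℕ; suc)
open import Data.Integer using (ℤ; _+_; _-_; +_)
open import Data.Product using (_×_)
open import Data.Sum using (_⊎_)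
open import Data.Fin using (Fin)
open import Data.Vec using (Vec)
open import Relation.Binary.PropositionalEquality using (_≡_)

open import Data.Bool using (if_then_else_)
open import Data.Bool.Properties using (∨-comm)
open import Data.Fin using (zero; suc; inject₁; fromℕ)
open import Data.Integer using (-_; _*_; _<_; _≤_; -≤+; 1ℤ; -1ℤ; pred) renaming (suc to sucℤ)
open import Data.Integer.Properties
  using (≤-refl; <-trans; <-≤-trans; <-irrefl; +-comm; +-monoˡ-≤; suc[i]≤j⇒i<j; i<j⇒i≤pred[j])
open import Data.Integer.Tactic.RingSolver using (solve-∀)
open import Data.Nat using (_∸_; _≡ᵇ_; z≤n; s≤s)
  renaming (_+_ to _+ℕ_; _*_ to _*ℕ_; _≤_ to _≤ℕ_; _≟_ to _≟ℕ_)
open import Data.Nat.Properties using (+-identityʳ; ⊔-comm) renaming (≤-refl to ≤ℕ-refl)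
open import Data.Product using (_,_; proj₁; proj₂)
open import Data.Sum using (inj₁; inj₂; swap) renaming (map to ⊎-map)
open import Data.Vec using ([]; _∷_; lookup)
open import Function using (_∘_)
open import Relation.Binary.PropositionalEquality using (_≢_; refl; sym; trans; cong; cong₂; subst)
open import Relation.Nullary using (¬_; yes; no)

F1-rule : ℕ → ℕ → ℕ → ℕ
F1-rule a b₊ b₋ = a ∸ 2 *ℕ ind4 a +ℕ ind4 b₊ +ℕ ind4 b₋

F1-value : ∀ (c : Config) d y {a b₊ b₋} →
           c y ≡ a → c (y +c dirVec d) ≡ b₊ → c (y +c negC (dirVec d)) ≡ b₋ →
           F1 c d y ≡ F1-rule a b₊ b₋
F1-value c d y refl refl refl = refl

F1-cong : ∀ {c c′ : Config} d → (∀ x → c x ≡ c′ x) → ∀ x → F1 c d x ≡ F1 c′ d x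
F1-cong {c} d eq x = F1-value c d x (eq x) (eq _) (eq _)

F-cong : ∀ {k} (Z : Vec Dir k) {c c′ : Config} → (∀ x → c x ≡ c′ x) → ∀ x → F c Z x ≡ F c′ Z x
F-cong []      eq = eq
F-cong (d ∷ Z) eq = F-cong Z (F1-cong d eq)

ind4-≤3 : ∀ {n} → n ≤ℕ 3 → ind4 n ≡ 0
ind4-≤3 z≤n                     = refl
ind4-≤3 (s≤s z≤n)               = refl
ind4-≤3 (s≤s (s≤s z≤n))         = refl
ind4-≤3 (s≤s (s≤s (s≤s z≤n)))   = refl

F1-rule-stable : ∀ {a b₊ b₋} → a ≤ℕ 3 → b₊ ≤ℕ 3 → b₋ ≤ℕ 3 → F1-rule a b₊ b₋ ≡ a
F1-rule-stable a≤3 b₊≤3 b₋≤3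
  rewrite ind4-≤3 a≤3 | ind4-≤3 b₊≤3 | ind4-≤3 b₋≤3 = trans (+-identityʳ _) (+-identityʳ _)

F1-rule-fed₋ : ∀ {b} → b ≤ℕ 3 → F1-rule 3 b 4 ≡ 4
F1-rule-fed₋ b≤3 rewrite ind4-≤3 b≤3 = refl

F1-rule-fed₊ : ∀ {b} → b ≤ℕ 3 → F1-rule 3 4 b ≡ 4
F1-rule-fed₊ b≤3 rewrite ind4-≤3 b≤3 = refl

+c-negC-cancelʳ : ∀ x u → (x +c u) +c negC u ≡ x
+c-negC-cancelʳ (x₁ , x₂) (u₁ , u₂) = cong₂ _,_ (cancel x₁ u₁) (cancel x₂ u₂)
  where
  cancel : ∀ a b → (a + b) + - b ≡ a
  cancel = solve-∀

+c-negC-cancelˡ : ∀ x u → (x +c negC u) +c u ≡ x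
+c-negC-cancelˡ (x₁ , x₂) (u₁ , u₂) = cong₂ _,_ (cancel x₁ u₁) (cancel x₂ u₂)
  where
  cancel : ∀ a b → (a + - b) + b ≡ a
  cancel = solve-∀

fires-forward : ∀ (c : Config) d x → let e = dirVec d in
                c x ≡ 4 → c (x +c e) ≡ 3 → c ((x +c e) +c e) ≤ℕ 3 → F1 c d (x +c e) ≡ 4
fires-forward c d x c₄ c₃ c≤3 =
  trans (F1-value c d (x +c dirVec d) c₃ refl (trans (cong c (+c-negC-cancelʳ x (dirVec d))) c₄))
        (F1-rule-fed₋ c≤3)

fires-backward : ∀ (c : Config) d x → let e = negC (dirVec d) in
                 c x ≡ 4 → c (x +c e) ≡ 3 → c ((x +c e) +c e) ≤ℕ 3 → F1 c d (x +c e) ≡ 4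
fires-backward c d x c₄ c₃ c≤3 =
  trans (F1-value c d (x +c negC (dirVec d)) c₃ (trans (cong c (+c-negC-cancelˡ x (dirVec d))) c₄) refl)
        (F1-rule-fed₊ c≤3)

front-fires : ∀ (c : Config) α β d x → let s = step α β d in
              c x ≡ 4 → c (x +c s) ≡ 3 → c ((x +c s) +c s) ≤ℕ 3 → F1 c d (x +c s) ≡ 4
front-fires c plus  β     H = fires-forward c H
front-fires c minus β     H = fires-backward c H
front-fires c α     plus  V = fires-forward c V
front-fires c α     minus V = fires-backward c V

progress : Sign → Sign → Cell → ℤ
progress α β (x₁ , x₂) = sgn α * x₁ + sgn β * x₂

progress-+c : ∀ α β x u → progress α β (x +c u) ≡ progress α β x + progress α β u
progress-+c α β (x₁ , x₂) (u₁ , u₂) = linear (sgn α) (sgn β) x₁ x₂ u₁ u₂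
  where
  linear : ∀ a b x₁ x₂ u₁ u₂ → a * (x₁ + u₁) + b * (x₂ + u₂) ≡ (a * x₁ + b * x₂) + (a * u₁ + b * u₂)
  linear = solve-∀

progress-step : ∀ α β d → progress α β (step α β d) ≡ 1ℤ
progress-step plus  plus  H = refl
progress-step plus  minus H = refl
progress-step minus plus  H = refl
progress-step minus minus H = refl
progress-step plus  plus  V = refl
progress-step plus  minus V = refl
progress-step minus plus  V = refl
progress-step minus minus V = refl

-1≤progress-unit : ∀ α β d → -1ℤ ≤ progress α β (dirVec d) × -1ℤ ≤ progress α β (negC (dirVec d))
-1≤progress-unit plus  plus  H = -≤+ , ≤-refl
-1≤progress-unit plus  minus H = -≤+ , ≤-refl
-1≤progress-unit minus plus  H = ≤-refl , -≤+
-1≤progress-unit minus minus H = ≤-refl , -≤+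
-1≤progress-unit plus  plus  V = -≤+ , ≤-refl
-1≤progress-unit plus  minus V = ≤-refl , -≤+
-1≤progress-unit minus plus  V = -≤+ , ≤-refl
-1≤progress-unit minus minus V = ≤-refl , -≤+

i<sucℤi : ∀ i → i < sucℤ i
i<sucℤi i = suc[i]≤j⇒i<j ≤-refl

progress-next : ∀ α β d x → progress α β (x +c step α β d) ≡ sucℤ (progress α β x)
progress-next α β d x = trans (progress-+c α β x (step α β d))
                              (trans (cong (λ i → progress α β x + i) (progress-step α β d)) (+-comm (progress α β x) 1ℤ))

progress-<-next : ∀ α β d x → progress α β x < progress α β (x +c step α β d)
progress-<-next α β d x = subst (progress α β x <_) (sym (progress-next α β d x)) (i<sucℤi _)

pred-progress≤ : ∀ α β x u → -1ℤ ≤ progress α β u → pred (progress α β x) ≤ progress α β (x +c u)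
pred-progress≤ α β x u -1≤u =
  subst (pred (progress α β x) ≤_)
        (trans (+-comm _ (progress α β x)) (sym (progress-+c α β x u)))
        (+-monoˡ-≤ (progress α β x) -1≤u)

F1-stable-beyond : ∀ (c : Config) d α β r →
                   (∀ y → r < progress α β y → c y ≤ℕ 3) →
                   ∀ y → sucℤ r < progress α β y → F1 c d y ≡ c y
F1-stable-beyond c d α β r ≤3-beyond y sr<y =
  F1-rule-stable (≤3-beyond y (<-trans (i<sucℤi r) sr<y))
                (≤3-beyond _ (<-≤-trans r<pred (pred-progress≤ α β y _ -1≤e)))
                (≤3-beyond _ (<-≤-trans r<pred (pred-progress≤ α β y _ -1≤-e)))
  where
  r<pred : r < pred (progress α β y)
  r<pred = suc[i]≤j⇒i<j (i<j⇒i≤pred[j] sr<y)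
  -1≤e : -1ℤ ≤ progress α β (dirVec d)
  -1≤e = proj₁ (-1≤progress-unit α β d)
  -1≤-e : -1ℤ ≤ progress α β (negC (dirVec d))
  -1≤-e = proj₂ (-1≤progress-unit α β d)

IsZPathWith : ∀ {k} → Sign → Sign → Vec Dir k → (Fin (suc k) → Cell) → Set
IsZPathWith {k} α β Z P = (s : Fin k) → P (suc s) ≡ P (inject₁ s) +c step α β (lookup Z s)

progress-increasing : ∀ {k} (Z : Vec Dir k) α β P → IsZPathWith α β Z P →
                      ∀ s → progress α β (P zero) < progress α β (P (suc s))
progress-increasing (d ∷ Z) α β P path zero =
  subst (λ y → progress α β (P zero) < progress α β y) (sym (path zero)) (progress-<-next α β d (P zero))
progress-increasing (d ∷ Z) α β P path (suc s) =
  <-trans (progress-increasing (d ∷ Z) α β P path zero)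
          (progress-increasing Z α β (P ∘ suc) (path ∘ suc) s)

path-leaves-start : ∀ {k} (Z : Vec Dir k) P → IsZPath Z P → ∀ s → P (suc s) ≢ P zero
path-leaves-start Z P (α , β , path) s eq =
  <-irrefl (cong (progress α β) (sym eq)) (progress-increasing Z α β P path s)

propagate : ∀ {k} (Z : Vec Dir k) α β P (c : Config) → IsZPathWith α β Z P →
            c (P zero) ≡ 4 →
            (∀ y → progress α β (P zero) < progress α β y → c y ≤ℕ 3) →
            (∀ s → c (P (suc s)) ≡ 3) →
            F c Z (P (fromℕ k)) ≡ 4
propagate []      α β P c path c₄ ≤3-beyond on-path = c₄
propagate (d ∷ Z) α β P c path c₄ ≤3-beyond on-path =
  propagate Z α β (P ∘ suc) (F1 c d) (path ∘ suc) fired ≤3-beyond′ on-path′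
  where
  x : Cell
  x = P zero
  s : Cell
  s = step α β d
  fired : F1 c d (P (suc zero)) ≡ 4
  fired = subst (λ y → F1 c d y ≡ 4) (sym (path zero))
    (front-fires c α β d x c₄ (subst (λ y → c y ≡ 3) (path zero) (on-path zero))
      (≤3-beyond _ (<-trans (progress-<-next α β d x) (progress-<-next α β d (x +c s)))))
  unchanged : ∀ y → progress α β (P (suc zero)) < progress α β y → F1 c d y ≡ c y
  unchanged y lt = F1-stable-beyond c d α β (progress α β x) ≤3-beyond y
    (subst (_< progress α β y) (trans (cong (progress α β) (path zero)) (progress-next α β d x)) lt)
  ≤3-beyond′ : ∀ y → progress α β (P (suc zero)) < progress α β y → F1 c d y ≤ℕ 3
  ≤3-beyond′ y lt = subst (_≤ℕ 3) (sym (unchanged y lt))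
                          (≤3-beyond y (<-trans (progress-increasing (d ∷ Z) α β P path zero) lt))
  on-path′ : ∀ s → F1 c d (P (suc (suc s))) ≡ 3
  on-path′ s = trans (unchanged _ (progress-increasing Z α β (P ∘ suc) (path ∘ suc) s)) (on-path (suc s))

signal : ∀ {k} (Z : Vec Dir k) P (c : Config) o → IsZPath Z P → P zero ≡ o →
         c o ≡ 4 → (∀ y → y ≢ o → c y ≤ℕ 3) → (∀ s → c (P (suc s)) ≡ 3) →
         F c Z (P (fromℕ k)) ≡ 4
signal Z P c .(P zero) (α , β , path) refl c₄ ≤3-elsewhere on-path =
  propagate Z α β P c path c₄ (λ y lt → ≤3-elsewhere y λ { refl → <-irrefl refl lt }) on-path

⊕-comm : ∀ (c₁ c₂ : Config) x → (c₁ ⊕ c₂) x ≡ (c₂ ⊕ c₁) x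
⊕-comm c₁ c₂ x = cong₂ (λ b m → if b then 2 else m)
                       (∨-comm (c₁ x ≡ᵇ 2) (c₂ x ≡ᵇ 2)) (⊔-comm (c₁ x) (c₂ x))

⊕-≤3 : ∀ (c₁ c₂ : Config) x → c₁ x ≡ 0 ⊎ c₁ x ≡ 3 → c₂ x ≡ 0 ⊎ c₂ x ≡ 3 → (c₁ ⊕ c₂) x ≤ℕ 3
⊕-≤3 c₁ c₂ x p q with c₁ x | c₂ x
⊕-≤3 c₁ c₂ x (inj₁ refl) (inj₁ refl) | .0 | .0 = z≤n
⊕-≤3 c₁ c₂ x (inj₁ refl) (inj₂ refl) | .0 | .3 = ≤ℕ-refl
⊕-≤3 c₁ c₂ x (inj₂ refl) (inj₁ refl) | .3 | .0 = ≤ℕ-refl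
⊕-≤3 c₁ c₂ x (inj₂ refl) (inj₂ refl) | .3 | .3 = ≤ℕ-refl

⊕-4 : ∀ (c₁ c₂ : Config) x → c₁ x ≡ 3 ⊎ c₁ x ≡ 4 → c₂ x ≡ 3 ⊎ c₂ x ≡ 4 →
      c₁ x ≡ 4 ⊎ c₂ x ≡ 4 → (c₁ ⊕ c₂) x ≡ 4
⊕-4 c₁ c₂ x p q r with c₁ x | c₂ x
⊕-4 c₁ c₂ x (inj₁ refl) (inj₁ refl) (inj₁ ()) | .3 | .3
⊕-4 c₁ c₂ x (inj₁ refl) (inj₁ refl) (inj₂ ()) | .3 | .3
⊕-4 c₁ c₂ x (inj₁ refl) (inj₂ refl) _ | .3 | .4 = refl
⊕-4 c₁ c₂ x (inj₂ refl) (inj₁ refl) _ | .4 | .3 = refl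
⊕-4 c₁ c₂ x (inj₂ refl) (inj₂ refl) _ | .4 | .4 = refl

⊕-3 : ∀ (c₁ c₂ : Config) x → c₁ x ≡ 3 → c₂ x ≡ 0 ⊎ c₂ x ≡ 3 → (c₁ ⊕ c₂) x ≡ 3
⊕-3 c₁ c₂ x p q with c₁ x | c₂ x
⊕-3 c₁ c₂ x refl (inj₁ refl) | .3 | .0 = refl
⊕-3 c₁ c₂ x refl (inj₂ refl) | .3 | .3 = refl

record Bridge {k} (Z : Vec Dir k) (o q : Cell) (P : Fin (suc k) → Cell) (c : Config) : Set where
  field
    isZPath   : IsZPath Z P
    start     : P zero ≡ o
    end       : P (fromℕ k) ≡ q
    origin    : c o ≡ 3 ⊎ c o ≡ 4
    along     : ∀ s → c (P (suc s)) ≡ 3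
    elsewhere : ∀ y → y ≢ o → c y ≡ 0 ⊎ c y ≡ 3

open Bridge

zero-or-three : ∀ {A : Set} {n} → (A → n ≡ 3) → (¬ A → n ≡ 0) → n ≡ 0 ⊎ n ≡ 3
zero-or-three {n = n} on off with n ≟ℕ 3
... | yes n≡3 = inj₂ n≡3
... | no  n≢3 = inj₁ (off (n≢3 ∘ on))

positive-bridge : ∀ {k} {Z : Vec Dir k} {o q P c} → PositiveBridge Z o q P c → Bridge Z o q P c
positive-bridge {P = P} (zp , start , end , on , off) = record
  { isZPath   = zp
  ; start     = start
  ; end       = end
  ; origin    = inj₁ (on _ (zero , start))
  ; along     = λ s → on (P (suc s)) (suc s , refl)
  ; elsewhere = λ y _ → zero-or-three (on y) (off y)
  }

source-origin : ∀ {k} {Z : Vec Dir k} {o q P c} → SourceBridge Z o q P c → c o ≡ 4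
source-origin {c = c} (_ , start , _ , c₄ , _) = subst (λ y → c y ≡ 4) start c₄

source-bridge : ∀ {k} {Z : Vec Dir k} {o q P c} → SourceBridge Z o q P c → Bridge Z o q P c
source-bridge {Z = Z} {P = P} T@(zp , start , end , _ , on , off) = record
  { isZPath   = zp
  ; start     = start
  ; end       = end
  ; origin    = inj₂ (source-origin {Z = Z} {P = P} T)
  ; along     = λ s → on (P (suc s)) (suc s , refl) (path-leaves-start Z P zp s)
  ; elsewhere = λ y y≢o → zero-or-three (λ y∈P → on y y∈P (y≢o ∘ λ eq → trans eq start)) (off y)
  }

bridge : ∀ {k} {Z : Vec Dir k} {o q P c} → PositiveBridge Z o q P c ⊎ SourceBridge Z o q P c → Bridge Z o q P c
bridge (inj₁ T) = positive-bridge T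
bridge (inj₂ T) = source-bridge T

⊕-signal : ∀ {k} {Z : Vec Dir k} {o q₁ q₂ P₁ P₂} {c₁ c₂ : Config} →
           Bridge Z o q₁ P₁ c₁ → Bridge Z o q₂ P₂ c₂ → c₁ o ≡ 4 ⊎ c₂ o ≡ 4 →
           F (c₁ ⊕ c₂) Z q₁ ≡ 4
⊕-signal {Z = Z} {o} {P₁ = P₁} {c₁ = c₁} {c₂} T₁ T₂ source =
  subst (λ y → F (c₁ ⊕ c₂) Z y ≡ 4) (end T₁)
    (signal Z P₁ (c₁ ⊕ c₂) o (isZPath T₁) (start T₁)
      (⊕-4 c₁ c₂ o (origin T₁) (origin T₂) source)
      (λ y y≢o → ⊕-≤3 c₁ c₂ y (elsewhere T₁ y y≢o) (elsewhere T₂ y y≢o))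
      (λ s → ⊕-3 c₁ c₂ _ (along T₁ s) (elsewhere T₂ _ (leaves s))))
  where
  leaves : ∀ s → P₁ (suc s) ≢ o
  leaves s eq = path-leaves-start Z P₁ (isZPath T₁) s (trans eq (sym (start T₁)))

corollary2 : ∀ {k} (Z : Vec Dir k) (a : Cell) (i j : ℤ)
    (P₁ P₂ : Fin (suc k) → Cell) (c₁ c₂ : Config) →
    let h = #H Z
        v = #V Z
        B₁⁺ = blockCorner a h v i j
        B₂⁺ = blockCorner a h v (i + + 1) (j - + 1)
        B₃⁺ = blockCorner a h v (i + + 1) (j + + 1)
    in (PositiveBridge Z B₁⁺ B₂⁺ P₁ c₁ ⊎ SourceBridge Z B₁⁺ B₂⁺ P₁ c₁) →
       (PositiveBridge Z B₁⁺ B₃⁺ P₂ c₂ ⊎ SourceBridge Z B₁⁺ B₃⁺ P₂ c₂) →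
       (SourceBridge Z B₁⁺ B₂⁺ P₁ c₁ ⊎ SourceBridge Z B₁⁺ B₃⁺ P₂ c₂) →
       (F (c₁ ⊕ c₂) Z B₂⁺ ≡ 4 × F (c₁ ⊕ c₂) Z B₃⁺ ≡ 4)
corollary2 Z a i j P₁ P₂ c₁ c₂ T₁ T₂ some-source =
  ⊕-signal bridge₁ bridge₂ source ,
  trans (F-cong Z (⊕-comm c₁ c₂) _) (⊕-signal bridge₂ bridge₁ (swap source))
  where
  B : ℤ → ℤ → Cell
  B = blockCorner a (#H Z) (#V Z)
  bridge₁ : Bridge Z (B i j) (B (i + + 1) (j - + 1)) P₁ c₁
  bridge₁ = bridge {P = P₁} T₁
  bridge₂ : Bridge Z (B i j) (B (i + + 1) (j + + 1)) P₂ c₂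
  bridge₂ = bridge {P = P₂} T₂
  source : c₁ (B i j) ≡ 4 ⊎ c₂ (B i j) ≡ 4
  source = ⊎-map (source-origin {Z = Z} {P = P₁}) (source-origin {Z = Z} {P = P₂}) some-source
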